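{- The minimum number of subgraphs in a $\{K_3,K_4\}$-decomposition of the complete graph $K_{19}$ is $D(19,\{3,4\})=35$, and an optimal (minimum) $\{K_3,K_4\}$-decomposition of $K_{19}$ consists of $13$ copies of $K_3$ and $22$ copies of $K_4$.
   Context: A $\{K_3,K_4\}$-decomposition of $K_v$ is a collection of subgraphs of $K_v$, each isomorphic to $K_3$ or $K_4$, whose edge sets partition $E(K_v)$. $D(v,\{3,4\})$ denotes the minimum number of subgraphs in a $\{K_3,K_4\}$-decomposition of $K_v$. -}

module Defs where

open import Data.Nat using (ℕ; _≤_)
open import Data.Fin using (Fin)
open import Data.Fin.Properties using () renaming (_≟_ to _≟ᶠ_)
open import Data.List using (List; length; filter)
open import Data.List.Relation.Unary.All using (All)
open import Data.List.Relation.Unary.Unique.Propositional using (Unique)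
import Data.List.Membership.DecPropositional as DecMem
open import Data.List.Membership.Propositional using (_∈_)
open import Data.Product using (_×_; Σ-syntax)
open import Data.Sum using (_⊎_)
open import Relation.Nullary.Decidable using (_×-dec_)
open import Relation.Binary.PropositionalEquality using (_≡_; _≢_)
import Data.Nat as ℕ

-- A complete subgraph K_k of K_n (vertex set Fin n) is determined by its
-- vertex set; we represent it as a duplicate-free list of vertices.
Block : ℕ → Set
Block n = List (Fin n)

IsK3orK4 : {n : ℕ} → Block n → Set
IsK3orK4 b = Unique b × (length b ≡ 3 ⊎ length b ≡ 4)

edgeMultiplicity : {n : ℕ} → List (Block n) → Fin n → Fin n → ℕ
edgeMultiplicity {n} D u v = length (filter (λ b → (u ∈? b) ×-dec (v ∈? b)) D)
  where
    open DecMem (_≟ᶠ_ {n}) using (_∈?_)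

IsK34Decomposition : (n : ℕ) → List (Block n) → Set
IsK34Decomposition n D =
  All IsK3orK4 D × (∀ (u v : Fin n) → u ≢ v → edgeMultiplicity D u v ≡ 1)

DK34≡ : ℕ → ℕ → Set
DK34≡ n m =
  (Σ[ D ∈ List (Block n) ] (IsK34Decomposition n D × length D ≡ m))
  × (∀ (D : List (Block n)) → IsK34Decomposition n D → m ≤ length D)

numK3 : {n : ℕ} → List (Block n) → ℕ
numK3 D = length (filter (λ b → length b ℕ.≟ 3) D)

numK4 : {n : ℕ} → List (Block n) → ℕ
numK4 D = length (filter (λ b → length b ℕ.≟ 4) D)

module Submission where

open import Defs
open import Data.Bool using (if_then_else_)
open import Data.Empty using (⊥)
open import Data.Fin using (Fin; zero; suc; toℕ; #_)
open import Data.Fin.Properties using (all?) renaming (_≟_ to _≟ᶠ_)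
open import Data.List using (List; []; _∷_; length; filter; lookup)
open import Data.List.Membership.Propositional.Properties using (∈-lookup)
import Data.List.Relation.Unary.All as All
open import Data.List.Relation.Unary.All.Properties using (All¬⇒¬Any)
open import Data.List.Relation.Unary.AllPairs using (_∷_)
open import Data.List.Relation.Unary.Unique.Propositional using (Unique)
open import Data.Nat using (ℕ; zero; suc; _+_; _*_; _∸_; _/_; _%_; _≤_; _<_; z≤n; s≤s; _≟_; _≤?_)
open import Data.Nat.DivMod using (m≡m%n+[m/n]*n)
open import Data.Nat.Properties
open import Algebra.Properties.Semiring.Sum +-*-semiring
  using (sum; sum-syntax; ∑-distrib-+; ∑-comm; *-distribˡ-sum; *-distribʳ-sum; sum-cong-≗)
open import Data.Nat.Tactic.RingSolver using (solve-∀)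
open import Data.Product using (_×_; _,_; ∃; proj₁; proj₂)
open import Data.Sum using (_⊎_; inj₁; inj₂)
open import Function using (_∘_)
open import Relation.Binary.PropositionalEquality
  using (_≡_; _≢_; refl; sym; trans; cong; cong₂; subst; module ≡-Reasoning)
open import Relation.Nullary using (Dec; yes; no; does; ¬_; ¬?; contradiction)
open import Relation.Nullary.Decidable using (from-yes; _×-dec_; _⊎-dec_; _→-dec_)
import Data.List.Membership.DecPropositional as DecMembership
import Data.List.Relation.Unary.Unique.DecPropositional as UniqueDec

-- Write r₃ v, r₄ v for the numbers of triangles and K₄s at a vertex v, and b₃, b₄ for their totals.
-- Counting the 18 edges at v and the 171 edges of K₁₉ gives 2 r₃ v + 3 r₄ v = 18 and b₃ + 2 b₄ = 57,
-- so a decomposition has 57 − b₄ blocks; an explicit decomposition has b₄ = 22, and it remains to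
-- show b₄ ≤ 22.
--
-- Suppose b₄ ≥ 23. Let S be the s vertices on no triangle (they have r₄ = 6) and T the t others
-- (r₄ ≤ 4); nS and nT count the S- and T-vertices of a block. Then 4 b₄ ≤ 6 s + 4 t forces s ≥ 8,
-- while a K₄ through a T-vertex v holds at most three S-vertices, so s ≤ 3 r₄ v; hence every T-vertex
-- has (r₃, r₄) = (3, 4), and s ≤ 12. Counting the T-vertices met around each vertex gives ∑ nT = 7 t
-- and ∑ nT² = (t + 6) t; taking off the t triangles (nT = 3) and using (nT − 1)(nT − 2) ≥ 0 on the K₄s
-- leaves only s = 8, t = 11, b₄ = 23, with ∑ nT = 44 and ∑ nT² = 88 over the K₄s. Each S-vertex meets
-- the odd number 11 of T-vertices, so lies in a K₄ with nT odd; with the moments this forces exactly one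
-- K₄ with nT = 3 and none with nT ∈ {0, 4}. Its S-vertex z lies in one more K₄ with nT = 1 than with
-- nT = 3, while every T-vertex lies in equally many of each. So the T-vertex u of a K₄ with nT = 1
-- through z also lies in the unique K₄ with nT = 3, and the edge z u is covered twice.

-- Defined through `does`, so that 𝟙 (suc j ≟ suc k) reduces to 𝟙 (j ≟ k).
𝟙 : ∀ {a} {A : Set a} → Dec A → ℕ
𝟙 d = if does d then 1 else 0

𝟙-yes : ∀ {a} {A : Set a} (d : Dec A) → A → 𝟙 d ≡ 1
𝟙-yes (yes _) _ = refl
𝟙-yes (no ¬a) a = contradiction a ¬a

𝟙-no : ∀ {a} {A : Set a} (d : Dec A) → ¬ A → 𝟙 d ≡ 0
𝟙-no (yes a) ¬a = contradiction a ¬a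
𝟙-no (no _)  _  = refl

𝟙≤1 : ∀ {a} {A : Set a} (d : Dec A) → 𝟙 d ≤ 1
𝟙≤1 (yes _) = s≤s z≤n
𝟙≤1 (no _)  = z≤n

𝟙-×-dec : ∀ {a b} {A : Set a} {B : Set b} (p : Dec A) (q : Dec B) → 𝟙 (p ×-dec q) ≡ 𝟙 p * 𝟙 q
𝟙-×-dec (yes _) (yes _) = refl
𝟙-×-dec (yes _) (no _)  = refl
𝟙-×-dec (no _)  _       = refl

𝟙-≟-subst : ∀ j k (f : ℕ → ℕ) → 𝟙 (j ≟ k) * f j ≡ 𝟙 (j ≟ k) * f k
𝟙-≟-subst j k f with j ≟ k
... | yes j≡k = cong (λ x → 𝟙 (j ≟ k) * f x) j≡k
... | no  j≢k = trans (cong (_* f j) (𝟙-no (j ≟ k) j≢k)) (sym (cong (_* f k) (𝟙-no (j ≟ k) j≢k)))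

𝟙≟1+𝟙≟3≤1 : ∀ j → 𝟙 (j ≟ 1) + 𝟙 (j ≟ 3) ≤ 1
𝟙≟1+𝟙≟3≤1 0                         = z≤n
𝟙≟1+𝟙≟3≤1 1                         = ≤-refl
𝟙≟1+𝟙≟3≤1 2                         = z≤n
𝟙≟1+𝟙≟3≤1 3                         = ≤-refl
𝟙≟1+𝟙≟3≤1 (suc (suc (suc (suc _)))) = z≤n

∑-const : ∀ n c → ∑[ i < n ] c ≡ n * c
∑-const zero    c = refl
∑-const (suc n) c = cong (c +_) (∑-const n c)

∑-zero : ∀ n → ∑[ i < n ] 0 ≡ 0
∑-zero n = trans (∑-const n 0) (*-zeroʳ n)

∑-linear : ∀ {k} p q {f g h : Fin k → ℕ} → (∀ i → f i ≡ p * g i + q * h i) →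
           sum f ≡ p * sum g + q * sum h
∑-linear p q {f} {g} {h} f≡pg+qh = begin
  sum f                                      ≡⟨ sum-cong-≗ f≡pg+qh ⟩
  sum (λ i → p * g i + q * h i)              ≡⟨ ∑-distrib-+ (λ i → p * g i) (λ i → q * h i) ⟩
  sum (λ i → p * g i) + sum (λ i → q * h i)  ≡⟨ sym (cong₂ _+_ (*-distribˡ-sum p g) (*-distribˡ-sum q h)) ⟩
  p * sum g + q * sum h                      ∎
  where open ≡-Reasoning

∑-mono-≤ : ∀ {n} {f g : Fin n → ℕ} → (∀ i → f i ≤ g i) → sum f ≤ sum g
∑-mono-≤ {zero}  f≤g = z≤n
∑-mono-≤ {suc n} f≤g = +-mono-≤ (f≤g zero) (∑-mono-≤ (f≤g ∘ suc))

term≤∑ : ∀ {n} (f : Fin n → ℕ) i → f i ≤ sum f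
term≤∑ f zero    = m≤m+n _ _
term≤∑ f (suc i) = ≤-trans (term≤∑ (f ∘ suc) i) (m≤n+m _ (f zero))

∑≡0⇒≡0 : ∀ {n} (f : Fin n → ℕ) → sum f ≡ 0 → ∀ i → f i ≡ 0
∑≡0⇒≡0 f ∑≡0 i = n≤0⇒n≡0 (subst (f i ≤_) ∑≡0 (term≤∑ f i))

∑>0⇒∃>0 : ∀ {n} (f : Fin n → ℕ) → 0 < sum f → ∃ λ i → 0 < f i
∑>0⇒∃>0 {suc n} f 0<∑ with 0 <? f zero
... | yes 0<f₀ = zero , 0<f₀
... | no  0≮f₀ with ∑>0⇒∃>0 (f ∘ suc) (subst (λ k → 0 < k + sum (f ∘ suc)) (n<1⇒n≡0 (≰⇒> 0≮f₀)) 0<∑)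
...   | i , 0<fᵢ = suc i , 0<fᵢ

∑-δ : ∀ {n} (v : Fin n) (g : Fin n → ℕ) → ∑[ w < n ] (𝟙 (w ≟ᶠ v) * g w) ≡ g v
∑-δ {suc n} zero    g = trans (cong₂ _+_ (+-identityʳ (g zero)) (∑-zero n)) (+-identityʳ (g zero))
∑-δ {suc n} (suc v) g = ∑-δ v (g ∘ suc)

∑-δℕ : ∀ {m} j → j < m → (f : ℕ → ℕ) → ∑[ i < m ] (𝟙 (j ≟ toℕ i) * f (toℕ i)) ≡ f j
∑-δℕ {suc m} zero    _         f = trans (cong₂ _+_ (+-identityʳ (f 0)) (∑-zero m)) (+-identityʳ (f 0))
∑-δℕ {suc m} (suc j) (s≤s j<m) f = ∑-δℕ j j<m (f ∘ suc)

length-filter≡∑𝟙 : ∀ {a p} {A : Set a} {P : A → Set p} (P? : ∀ x → Dec (P x)) (xs : List A) →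
                   length (filter P? xs) ≡ ∑[ i < length xs ] 𝟙 (P? (lookup xs i))
length-filter≡∑𝟙 P? []       = refl
length-filter≡∑𝟙 P? (x ∷ xs) with P? x
... | yes _ = cong suc (length-filter≡∑𝟙 P? xs)
... | no  _ = length-filter≡∑𝟙 P? xs

inclusion–exclusion : ∀ {c a d} → c ≤ 1 → a ≤ 1 → d ≤ 1 → c * a + c * d ≤ c * a * d + c
inclusion–exclusion z≤n       _         _         = z≤n
inclusion–exclusion (s≤s z≤n) z≤n       z≤n       = z≤n
inclusion–exclusion (s≤s z≤n) z≤n       (s≤s z≤n) = ≤-refl
inclusion–exclusion (s≤s z≤n) (s≤s z≤n) z≤n       = ≤-refl
inclusion–exclusion (s≤s z≤n) (s≤s z≤n) (s≤s z≤n) = ≤-refl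

-- Incidence counting for a family of blocks

module _ {n : ℕ} where
  open DecMembership (_≟ᶠ_ {n}) using (_∈?_)

  χ : Block n → Fin n → ℕ
  χ B v = 𝟙 (v ∈? B)

  χ≤1 : ∀ B v → χ B v ≤ 1
  χ≤1 B v = 𝟙≤1 (v ∈? B)

  χ*χ≡χ : ∀ B v → χ B v * χ B v ≡ χ B v
  χ*χ≡χ B v with v ∈? B
  ... | yes _ = refl
  ... | no  _ = refl

  χ-∷ : ∀ {u} {B : Block n} → Unique (u ∷ B) → ∀ v → χ (u ∷ B) v ≡ 𝟙 (v ≟ᶠ u) + χ B v
  χ-∷ {u} {B} (u∉B ∷ _) v with v ≟ᶠ u
  ... | yes refl = cong suc (sym (𝟙-no (v ∈? B) (All¬⇒¬Any u∉B)))
  ... | no  _    = refl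

  ∑χ≡length : (B : Block n) → Unique B → ∑[ v < n ] χ B v ≡ length B
  ∑χ≡length []      _              = ∑-zero n
  ∑χ≡length (u ∷ B) uB@(_ ∷ uniq) = begin
    ∑[ v < n ] χ (u ∷ B) v                     ≡⟨ sum-cong-≗ (χ-∷ uB) ⟩
    ∑[ v < n ] (𝟙 (v ≟ᶠ u) + χ B v)            ≡⟨ ∑-distrib-+ (λ v → 𝟙 (v ≟ᶠ u)) (χ B) ⟩
    ∑[ v < n ] 𝟙 (v ≟ᶠ u) + ∑[ v < n ] χ B v  ≡⟨ cong₂ _+_ ∑𝟙≡1 (∑χ≡length B uniq) ⟩
    suc (length B)                             ∎
    where
      open ≡-Reasoning
      ∑𝟙≡1 : ∑[ v < n ] 𝟙 (v ≟ᶠ u) ≡ 1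
      ∑𝟙≡1 = trans (sum-cong-≗ (λ v → sym (*-identityʳ (𝟙 (v ≟ᶠ u))))) (∑-δ u (λ _ → 1))

  edgeMultiplicity≡∑χχ : (D : List (Block n)) (u v : Fin n) →
                         edgeMultiplicity D u v ≡ ∑[ i < length D ] (χ (lookup D i) u * χ (lookup D i) v)
  edgeMultiplicity≡∑χχ D u v = trans (length-filter≡∑𝟙 (λ B → (u ∈? B) ×-dec (v ∈? B)) D)
                                     (sum-cong-≗ (λ i → 𝟙-×-dec (u ∈? lookup D i) (v ∈? lookup D i)))

module Incidence {n : ℕ} (D : List (Block n)) where

  m : ℕ
  m = length D

  block : Fin m → Block n
  block = lookup D

  inc : Fin m → Fin n → ℕ
  inc i = χ (block i)

  CoversPairsOnce : Set
  CoversPairsOnce = ∀ u v → u ≢ v → edgeMultiplicity D u v ≡ 1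

  weight : (Fin n → ℕ) → Fin m → ℕ
  weight X i = ∑[ w < n ] (inc i w * X w)

  size : Fin m → ℕ
  size = weight (λ _ → 1)

  size≡length : ∀ i → Unique (block i) → size i ≡ length (block i)
  size≡length i uniq = trans (sum-cong-≗ (λ w → *-identityʳ (inc i w))) (∑χ≡length (block i) uniq)

  through : (Fin m → ℕ) → Fin n → ℕ
  through c v = ∑[ i < m ] (c i * inc i v)

  deg : Fin n → ℕ
  deg = through (λ _ → 1)

  weight-+ : ∀ X Y i → weight X i + weight Y i ≡ weight (λ w → X w + Y w) i
  weight-+ X Y i = trans (sym (∑-distrib-+ (λ w → inc i w * X w) (λ w → inc i w * Y w)))
                         (sum-cong-≗ (λ w → sym (*-distribˡ-+ (inc i w) (X w) (Y w))))

  double-count : ∀ c X → ∑[ i < m ] (c i * weight X i) ≡ ∑[ w < n ] (through c w * X w)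
  double-count c X = begin
    ∑[ i < m ] (c i * ∑[ w < n ] (inc i w * X w))
      ≡⟨ sum-cong-≗ (λ i → *-distribˡ-sum (c i) (λ w → inc i w * X w)) ⟩
    ∑[ i < m ] ∑[ w < n ] (c i * (inc i w * X w))
      ≡⟨ ∑-comm (λ i w → c i * (inc i w * X w)) ⟩
    ∑[ w < n ] ∑[ i < m ] (c i * (inc i w * X w))
      ≡⟨ sum-cong-≗ (λ w → sum-cong-≗ (λ i → sym (*-assoc (c i) (inc i w) (X w)))) ⟩
    ∑[ w < n ] ∑[ i < m ] (c i * inc i w * X w)
      ≡⟨ sum-cong-≗ (λ w → sym (*-distribʳ-sum (X w) (λ i → c i * inc i w))) ⟩
    ∑[ w < n ] (through c w * X w)
      ∎
    where open ≡-Reasoning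

  through-self : ∀ v → through (λ i → inc i v) v ≡ deg v
  through-self v = sum-cong-≗ (λ i → trans (χ*χ≡χ (block i) v) (sym (*-identityˡ (inc i v))))

  neighbourhood-sum : CoversPairsOnce → ∀ v X →
                      ∑[ i < m ] (inc i v * weight X i) + X v ≡ ∑[ w < n ] X w + deg v * X v
  neighbourhood-sum once v X = begin
    ∑[ i < m ] (inc i v * weight X i) + X v
      ≡⟨ cong₂ _+_ (double-count (λ i → inc i v) X) (sym (∑-δ v X)) ⟩
    ∑[ w < n ] (pairs w * X w) + ∑[ w < n ] (𝟙 (w ≟ᶠ v) * X w)
      ≡⟨ sym (∑-distrib-+ (λ w → pairs w * X w) _) ⟩
    ∑[ w < n ] (pairs w * X w + 𝟙 (w ≟ᶠ v) * X w)
      ≡⟨ sum-cong-≗ split ⟩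
    ∑[ w < n ] (X w + 𝟙 (w ≟ᶠ v) * (deg w * X w))
      ≡⟨ ∑-distrib-+ X _ ⟩
    ∑[ w < n ] X w + ∑[ w < n ] (𝟙 (w ≟ᶠ v) * (deg w * X w))
      ≡⟨ cong (∑[ w < n ] X w +_) (∑-δ v (λ w → deg w * X w)) ⟩
    ∑[ w < n ] X w + deg v * X v
      ∎
    where
      open ≡-Reasoning
      pairs : Fin n → ℕ
      pairs = through (λ i → inc i v)

      pairs≡1 : ∀ w → w ≢ v → pairs w ≡ 1
      pairs≡1 w w≢v = trans (sym (edgeMultiplicity≡∑χχ D v w)) (once v w (w≢v ∘ sym))

      split : ∀ w → pairs w * X w + 𝟙 (w ≟ᶠ v) * X w ≡ X w + 𝟙 (w ≟ᶠ v) * (deg w * X w)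
      split w with w ≟ᶠ v
      ... | yes refl = trans (cong (λ d → d * X w + 1 * X w) (through-self w)) (swap (deg w) (X w))
        where swap : ∀ d x → d * x + 1 * x ≡ x + 1 * (d * x)
              swap = solve-∀
      ... | no  w≢v  = trans (cong (λ p → p * X w + 0) (pairs≡1 w w≢v)) (cong (_+ 0) (*-identityˡ (X w)))

  common-block : ∀ {c : Fin m → ℕ} → (∀ i → c i ≤ 1) → sum c ≤ 1 →
                 ∀ {u v} → 0 < through c u → 0 < through c v → 0 < ∑[ i < m ] (c i * inc i u * inc i v)
  common-block {c} c≤1 ∑c≤1 {u} {v} 0<u 0<v = +-cancelʳ-≤ 1 1 _ (begin
    2
      ≤⟨ +-mono-≤ 0<u 0<v ⟩
    through c u + through c v
      ≡⟨ sym (∑-distrib-+ (λ i → c i * inc i u) _) ⟩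
    ∑[ i < m ] (c i * inc i u + c i * inc i v)
      ≤⟨ ∑-mono-≤ (λ i → inclusion–exclusion (c≤1 i) (χ≤1 (block i) u) (χ≤1 (block i) v)) ⟩
    ∑[ i < m ] (c i * inc i u * inc i v + c i)
      ≡⟨ ∑-distrib-+ (λ i → c i * inc i u * inc i v) c ⟩
    ∑[ i < m ] (c i * inc i u * inc i v) + sum c
      ≤⟨ +-monoʳ-≤ _ ∑c≤1 ⟩
    ∑[ i < m ] (c i * inc i u * inc i v) + 1
      ∎)
    where open ≤-Reasoning

  common-blocks≤1 : CoversPairsOnce → ∀ {c c′ : Fin m → ℕ} → (∀ i → c i + c′ i ≤ 1) → ∀ {u v} → u ≢ v →
                    ∑[ i < m ] (c i * inc i u * inc i v) + ∑[ i < m ] (c′ i * inc i u * inc i v) ≤ 1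
  common-blocks≤1 once {c} {c′} c+c′≤1 {u} {v} u≢v = begin
    ∑[ i < m ] (c i * inc i u * inc i v) + ∑[ i < m ] (c′ i * inc i u * inc i v)
      ≡⟨ sym (∑-distrib-+ (λ i → c i * inc i u * inc i v) _) ⟩
    ∑[ i < m ] (c i * inc i u * inc i v + c′ i * inc i u * inc i v)
      ≤⟨ ∑-mono-≤ disjoint ⟩
    ∑[ i < m ] (inc i u * inc i v)
      ≡⟨ sym (edgeMultiplicity≡∑χχ D u v) ⟩
    edgeMultiplicity D u v
      ≡⟨ once u v u≢v ⟩
    1
      ∎
    where
      open ≤-Reasoning
      disjoint : ∀ i → c i * inc i u * inc i v + c′ i * inc i u * inc i v ≤ inc i u * inc i v
      disjoint i = begin
        c i * inc i u * inc i v + c′ i * inc i u * inc i v  ≡⟨ regroup (c i) (c′ i) (inc i u) (inc i v) ⟩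
        (c i + c′ i) * (inc i u * inc i v)                  ≤⟨ *-monoˡ-≤ (inc i u * inc i v) (c+c′≤1 i) ⟩
        1 * (inc i u * inc i v)                             ≡⟨ *-identityˡ (inc i u * inc i v) ⟩
        inc i u * inc i v                                   ∎
        where regroup : ∀ c c′ a b → c * a * b + c′ * a * b ≡ (c + c′) * (a * b)
              regroup = solve-∀

-- {K₃,K₄}-decompositions of Kₙ

module K34Decomposition {n : ℕ} (D : List (Block n)) (decomposition : IsK34Decomposition n D) where
  open Incidence D public

  once : CoversPairsOnce
  once = proj₂ decomposition

  isK3 isK4 : Fin m → ℕ
  isK3 i = 𝟙 (length (block i) ≟ 3)
  isK4 i = 𝟙 (length (block i) ≟ 4)

  data Shape (i : Fin m) : Set where
    triangle : isK3 i ≡ 1 → isK4 i ≡ 0 → size i ≡ 3 → Shape i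
    quad     : isK3 i ≡ 0 → isK4 i ≡ 1 → size i ≡ 4 → Shape i

  shape : ∀ i → Shape i
  shape i = shapeOf (All.lookup (proj₁ decomposition) (∈-lookup i))
    where
      3≢4 : 3 ≢ 4
      3≢4 ()
      shapeOf : IsK3orK4 (block i) → Shape i
      shapeOf (uniq , inj₁ |B|≡3) =
        triangle (𝟙-yes (length (block i) ≟ 3) |B|≡3) (𝟙-no (length (block i) ≟ 4) (3≢4 ∘ trans (sym |B|≡3)))
                 (trans (size≡length i uniq) |B|≡3)
      shapeOf (uniq , inj₂ |B|≡4) =
        quad (𝟙-no (length (block i) ≟ 3) (λ |B|≡3 → 3≢4 (trans (sym |B|≡3) |B|≡4)))
             (𝟙-yes (length (block i) ≟ 4) |B|≡4)
             (trans (size≡length i uniq) |B|≡4)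

  r₃ r₄ : Fin n → ℕ
  r₃ = through isK3
  r₄ = through isK4

  b₃ b₄ : ℕ
  b₃ = sum isK3
  b₄ = sum isK4

  isK3+isK4≡1 : ∀ i → isK3 i + isK4 i ≡ 1
  isK3+isK4≡1 i with shape i
  ... | triangle k₃ k₄ _ = cong₂ _+_ k₃ k₄
  ... | quad     k₃ k₄ _ = cong₂ _+_ k₃ k₄

  size≡3isK3+4isK4 : ∀ i → size i ≡ 3 * isK3 i + 4 * isK4 i
  size≡3isK3+4isK4 i with shape i
  ... | triangle k₃ k₄ size≡3 rewrite k₃ | k₄ = size≡3
  ... | quad     k₃ k₄ size≡4 rewrite k₃ | k₄ = size≡4

  length≡b₃+b₄ : length D ≡ b₃ + b₄
  length≡b₃+b₄ = begin
    m                              ≡⟨ sym (*-identityʳ m) ⟩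
    m * 1                          ≡⟨ sym (∑-const m 1) ⟩
    ∑[ i < m ] 1                   ≡⟨ sum-cong-≗ (sym ∘ isK3+isK4≡1) ⟩
    ∑[ i < m ] (isK3 i + isK4 i)   ≡⟨ ∑-distrib-+ isK3 isK4 ⟩
    b₃ + b₄                        ∎
    where open ≡-Reasoning

  numK3≡b₃ : numK3 D ≡ b₃
  numK3≡b₃ = length-filter≡∑𝟙 (λ B → length B ≟ 3) D

  numK4≡b₄ : numK4 D ≡ b₄
  numK4≡b₄ = length-filter≡∑𝟙 (λ B → length B ≟ 4) D

  deg≡r₃+r₄ : ∀ v → deg v ≡ r₃ v + r₄ v
  deg≡r₃+r₄ v = trans (sum-cong-≗ split) (∑-distrib-+ (λ i → isK3 i * inc i v) (λ i → isK4 i * inc i v))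
    where
      split : ∀ i → 1 * inc i v ≡ isK3 i * inc i v + isK4 i * inc i v
      split i = trans (cong (_* inc i v) (sym (isK3+isK4≡1 i))) (*-distribʳ-+ (inc i v) (isK3 i) (isK4 i))

  vertex-equation : ∀ v → 2 * r₃ v + 3 * r₄ v + 1 ≡ n
  vertex-equation v = +-cancelʳ-≡ (r₃ v + r₄ v) _ _ (begin
    2 * r₃ v + 3 * r₄ v + 1 + (r₃ v + r₄ v)    ≡⟨ regroup (r₃ v) (r₄ v) ⟩
    3 * r₃ v + 4 * r₄ v + 1                    ≡⟨ cong (_+ 1) (sym (∑-linear 3 4 sizes)) ⟩
    ∑[ i < m ] (inc i v * size i) + 1          ≡⟨ neighbourhood-sum once v (λ _ → 1) ⟩
    ∑[ w < n ] 1 + deg v * 1                   ≡⟨ cong₂ _+_ (trans (∑-const n 1) (*-identityʳ n))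
                                                            (trans (*-identityʳ (deg v)) (deg≡r₃+r₄ v)) ⟩
    n + (r₃ v + r₄ v)                          ∎)
    where
      open ≡-Reasoning
      regroup : ∀ x y → 2 * x + 3 * y + 1 + (x + y) ≡ 3 * x + 4 * y + 1
      regroup = solve-∀
      sizes : ∀ i → inc i v * size i ≡ 3 * (isK3 i * inc i v) + 4 * (isK4 i * inc i v)
      sizes i rewrite size≡3isK3+4isK4 i = distrib (inc i v) (isK3 i) (isK4 i)
        where distrib : ∀ c k₃ k₄ → c * (3 * k₃ + 4 * k₄) ≡ 3 * (k₃ * c) + 4 * (k₄ * c)
              distrib = solve-∀

  ∑r₃≡3b₃ : ∑[ v < n ] r₃ v ≡ 3 * b₃
  ∑r₃≡3b₃ = begin
    ∑[ v < n ] r₃ v              ≡⟨ sum-cong-≗ (λ v → sym (*-identityʳ (r₃ v))) ⟩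
    ∑[ v < n ] (r₃ v * 1)        ≡⟨ sym (double-count isK3 (λ _ → 1)) ⟩
    ∑[ i < m ] (isK3 i * size i) ≡⟨ sum-cong-≗ per-block ⟩
    ∑[ i < m ] (3 * isK3 i)      ≡⟨ sym (*-distribˡ-sum 3 isK3) ⟩
    3 * b₃                       ∎
    where
      open ≡-Reasoning
      per-block : ∀ i → isK3 i * size i ≡ 3 * isK3 i
      per-block i with shape i
      ... | triangle k₃ _ size≡3 rewrite k₃ | size≡3 = refl
      ... | quad     k₃ _ _      rewrite k₃ = refl

  ∑r₄≡4b₄ : ∑[ v < n ] r₄ v ≡ 4 * b₄
  ∑r₄≡4b₄ = begin
    ∑[ v < n ] r₄ v              ≡⟨ sum-cong-≗ (λ v → sym (*-identityʳ (r₄ v))) ⟩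
    ∑[ v < n ] (r₄ v * 1)        ≡⟨ sym (double-count isK4 (λ _ → 1)) ⟩
    ∑[ i < m ] (isK4 i * size i) ≡⟨ sum-cong-≗ per-block ⟩
    ∑[ i < m ] (4 * isK4 i)      ≡⟨ sym (*-distribˡ-sum 4 isK4) ⟩
    4 * b₄                       ∎
    where
      open ≡-Reasoning
      per-block : ∀ i → isK4 i * size i ≡ 4 * isK4 i
      per-block i with shape i
      ... | triangle _ k₄ _      rewrite k₄ = refl
      ... | quad     _ k₄ size≡4 rewrite k₄ | size≡4 = refl

  edge-equation : 6 * (b₃ + 2 * b₄) + n ≡ n * n
  edge-equation = begin
    6 * (b₃ + 2 * b₄) + n
      ≡⟨ regroup b₃ b₄ n ⟩
    2 * (3 * b₃) + 3 * (4 * b₄) + n * 1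
      ≡⟨ sym (cong₂ _+_ (cong₂ (λ p q → 2 * p + 3 * q) ∑r₃≡3b₃ ∑r₄≡4b₄) (∑-const n 1)) ⟩
    2 * ∑[ v < n ] r₃ v + 3 * ∑[ v < n ] r₄ v + ∑[ v < n ] 1
      ≡⟨ sym (cong (_+ ∑[ v < n ] 1) (∑-linear 2 3 {g = r₃} {h = r₄} (λ _ → refl))) ⟩
    ∑[ v < n ] (2 * r₃ v + 3 * r₄ v) + ∑[ v < n ] 1
      ≡⟨ sym (∑-distrib-+ (λ v → 2 * r₃ v + 3 * r₄ v) (λ _ → 1)) ⟩
    ∑[ v < n ] (2 * r₃ v + 3 * r₄ v + 1)
      ≡⟨ sum-cong-≗ vertex-equation ⟩
    ∑[ v < n ] n
      ≡⟨ ∑-const n n ⟩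
    n * n
      ∎
    where
      open ≡-Reasoning
      regroup : ∀ a b n → 6 * (a + 2 * b) + n ≡ 2 * (3 * a) + 3 * (4 * b) + n * 1
      regroup = solve-∀

Solution₁₈ : ℕ → ℕ → Set
Solution₁₈ x y = (x ≡ 0 × y ≡ 6) ⊎ (x ≡ 3 × y ≡ 4) ⊎ (x ≡ 6 × y ≡ 2) ⊎ (x ≡ 9 × y ≡ 0)

2x+3y≡18⇒ : ∀ {x y} → 2 * x + 3 * y ≡ 18 → Solution₁₈ x y
2x+3y≡18⇒ {x} {y} e = search (s≤s x≤18) (s≤s y≤18) e
  where
    x≤18 : x ≤ 18
    x≤18 = subst (x ≤_) e (≤-trans (m≤m+n x (x + 0)) (m≤m+n (2 * x) (3 * y)))
    y≤18 : y ≤ 18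
    y≤18 = subst (y ≤_) e (≤-trans (m≤m+n y (y + (y + 0))) (m≤n+m (3 * y) (2 * x)))
    search : ∀ {x} → x < 19 → ∀ {y} → y < 19 → 2 * x + 3 * y ≡ 18 → Solution₁₈ x y
    search = from-yes (allUpTo? (λ x → allUpTo? (λ y → (2 * x + 3 * y ≟ 18) →-dec
               (((x ≟ 0) ×-dec (y ≟ 6)) ⊎-dec ((x ≟ 3) ×-dec (y ≟ 4)) ⊎-dec
                ((x ≟ 6) ×-dec (y ≟ 2)) ⊎-dec ((x ≟ 9) ×-dec (y ≟ 0)))) 19) 19)

3j≤j*j+2 : ∀ j → 3 * j ≤ j * j + 2
3j≤j*j+2 0                     = z≤n
3j≤j*j+2 1                     = ≤-refl
3j≤j*j+2 2                     = ≤-refl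
3j≤j*j+2 j@(suc (suc (suc _))) = ≤-trans (*-monoˡ-≤ j {3} {j} (s≤s (s≤s (s≤s z≤n)))) (m≤m+n (j * j) 2)

s≡8-forced : ∀ {s t} → s + t ≡ 19 → 8 ≤ s → s ≤ 12 → 42 * t ≤ 2 * ((t + 6) * t) + (6 * s + 4 * t) → s ≡ 8
s≡8-forced {s} {t} e = search (s≤s (subst (s ≤_) e (m≤m+n s t))) (s≤s (subst (t ≤_) e (m≤n+m t s))) e
  where
    search : ∀ {s} → s < 20 → ∀ {t} → t < 20 → s + t ≡ 19 → 8 ≤ s → s ≤ 12 →
             42 * t ≤ 2 * ((t + 6) * t) + (6 * s + 4 * t) → s ≡ 8
    search = from-yes (allUpTo? (λ s → allUpTo? (λ t → (s + t ≟ 19) →-dec (8 ≤? s) →-dec (s ≤? 12) →-dec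
               (42 * t ≤? 2 * ((t + 6) * t) + (6 * s + 4 * t)) →-dec (s ≟ 8)) 20) 20)

moment : (ℕ → ℕ) → (ℕ → ℕ) → ℕ
moment κ f = ∑[ k < 5 ] (f (toℕ k) * κ (toℕ k))

type-counts : ∀ κ → moment κ (λ _ → 1) ≡ 23 → moment κ (λ k → k) ≡ 44 → moment κ (λ k → k * k) ≡ 88 →
              8 ≤ moment κ (λ k → k % 2 * (4 ∸ k)) → κ 0 ≡ 0 × κ 3 ≡ 1 × κ 4 ≡ 0
type-counts κ m₀ m₁ m₂ odd =
  search (bound (≤-trans (m≤m+n κ₀ _) (≤-trans (m≤m+n (4 * κ₀) κ₁) (≤-trans (m≤m+n _ κ₃) (m≤m+n _ (4 * κ₄))))))
         (bound (≤-trans (m≤n+m κ₁ (4 * κ₀)) (≤-trans (m≤m+n _ κ₃) (m≤m+n _ (4 * κ₄)))))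
         (bound (≤-trans (m≤n+m κ₃ (4 * κ₀ + κ₁)) (m≤m+n _ (4 * κ₄))))
         (bound (≤-trans (m≤m+n κ₄ _) (m≤n+m (4 * κ₄) (4 * κ₀ + κ₁ + κ₃))))
         ½∑[k-1][k-2]κ≡1 ∑[k-2]²κ≡4 (subst (8 ≤_) (odd-moment κ₀ κ₁ κ₂ κ₃ κ₄) odd)
  where
    open ≡-Reasoning
    κ₀ κ₁ κ₂ κ₃ κ₄ : ℕ
    κ₀ = κ 0
    κ₁ = κ 1
    κ₂ = κ 2
    κ₃ = κ 3
    κ₄ = κ 4

    ½∑[k-1][k-2]κ ∑[k-2]²κ : ℕ
    ½∑[k-1][k-2]κ = κ₀ + κ₃ + 3 * κ₄
    ∑[k-2]²κ      = 4 * κ₀ + κ₁ + κ₃ + 4 * κ₄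

    [k-1][k-2]-identity : ∀ a b c d e →
      (1 * b + (4 * c + (9 * d + (16 * e + 0)))) + 2 * (1 * a + (1 * b + (1 * c + (1 * d + (1 * e + 0)))))
        ≡ 3 * (1 * b + (2 * c + (3 * d + (4 * e + 0)))) + 2 * (a + d + 3 * e)
    [k-1][k-2]-identity = solve-∀
    [k-2]²-identity : ∀ a b c d e →
      (1 * b + (4 * c + (9 * d + (16 * e + 0)))) + 4 * (1 * a + (1 * b + (1 * c + (1 * d + (1 * e + 0)))))
        ≡ 4 * (1 * b + (2 * c + (3 * d + (4 * e + 0)))) + (4 * a + b + d + 4 * e)
    [k-2]²-identity = solve-∀
    odd-moment : ∀ a b c d e → 0 * a + (3 * b + (0 * c + (1 * d + (0 * e + 0)))) ≡ 3 * b + d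
    odd-moment = solve-∀

    ½∑[k-1][k-2]κ≡1 : ½∑[k-1][k-2]κ ≡ 1
    ½∑[k-1][k-2]κ≡1 = *-cancelˡ-≡ _ 1 2 (+-cancelˡ-≡ 132 _ _ (begin
      132 + 2 * ½∑[k-1][k-2]κ                         ≡⟨ cong (λ p → 3 * p + 2 * ½∑[k-1][k-2]κ) (sym m₁) ⟩
      3 * moment κ (λ k → k) + 2 * ½∑[k-1][k-2]κ      ≡⟨ sym ([k-1][k-2]-identity κ₀ κ₁ κ₂ κ₃ κ₄) ⟩
      moment κ (λ k → k * k) + 2 * moment κ (λ _ → 1) ≡⟨ cong₂ (λ p q → p + 2 * q) m₂ m₀ ⟩
      134                                             ∎))

    ∑[k-2]²κ≡4 : ∑[k-2]²κ ≡ 4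
    ∑[k-2]²κ≡4 = +-cancelˡ-≡ 176 _ _ (begin
      176 + ∑[k-2]²κ                                  ≡⟨ cong (λ p → 4 * p + ∑[k-2]²κ) (sym m₁) ⟩
      4 * moment κ (λ k → k) + ∑[k-2]²κ               ≡⟨ sym ([k-2]²-identity κ₀ κ₁ κ₂ κ₃ κ₄) ⟩
      moment κ (λ k → k * k) + 4 * moment κ (λ _ → 1) ≡⟨ cong₂ (λ p q → p + 4 * q) m₂ m₀ ⟩
      180                                             ∎)

    bound : ∀ {k} → k ≤ ∑[k-2]²κ → k < 5
    bound {k} k≤ = s≤s (subst (k ≤_) ∑[k-2]²κ≡4 k≤)

    search : ∀ {a} → a < 5 → ∀ {b} → b < 5 → ∀ {d} → d < 5 → ∀ {e} → e < 5 →
             a + d + 3 * e ≡ 1 → 4 * a + b + d + 4 * e ≡ 4 → 8 ≤ 3 * b + d → a ≡ 0 × d ≡ 1 × e ≡ 0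
    search = from-yes (allUpTo? (λ a → allUpTo? (λ b → allUpTo? (λ d → allUpTo? (λ e →
               (a + d + 3 * e ≟ 1) →-dec (4 * a + b + d + 4 * e ≟ 4) →-dec (8 ≤? 3 * b + d) →-dec
               ((a ≟ 0) ×-dec (d ≟ 1) ×-dec (e ≟ 0))) 5) 5) 5) 5)

moment-balance : ∀ κ → κ 0 ≡ 0 → κ 4 ≡ 0 → 2 * moment κ (λ _ → 1) + κ 3 ≡ moment κ (λ k → k) + κ 1
moment-balance κ κ₀≡0 κ₄≡0 = begin
  2 * moment κ (λ _ → 1) + κ 3            ≡⟨ sym (+-identityʳ _) ⟩
  2 * moment κ (λ _ → 1) + κ 3 + 2 * 0    ≡⟨ cong (λ e → 2 * moment κ (λ _ → 1) + κ 3 + 2 * e) (sym κ₄≡0) ⟩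
  2 * moment κ (λ _ → 1) + κ 3 + 2 * κ 4  ≡⟨ identity (κ 0) (κ 1) (κ 2) (κ 3) (κ 4) ⟩
  moment κ (λ k → k) + κ 1 + 2 * κ 0      ≡⟨ cong (λ a → moment κ (λ k → k) + κ 1 + 2 * a) κ₀≡0 ⟩
  moment κ (λ k → k) + κ 1 + 2 * 0        ≡⟨ +-identityʳ _ ⟩
  moment κ (λ k → k) + κ 1                ∎
  where
    open ≡-Reasoning
    identity : ∀ a b c d e → 2 * (1 * a + (1 * b + (1 * c + (1 * d + (1 * e + 0))))) + d + 2 * e
                           ≡ 0 * a + (1 * b + (2 * c + (3 * d + (4 * e + 0)))) + b + 2 * a
    identity = solve-∀

a+2b≡a+b+b : ∀ a b → a + 2 * b ≡ a + b + b
a+2b≡a+b+b = solve-∀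

a+2b≡57⇒35≤a+b : ∀ {a b} → a + 2 * b ≡ 57 → b ≤ 22 → 35 ≤ a + b
a+2b≡57⇒35≤a+b {a} {b} e b≤22 = +-cancelʳ-≤ 22 35 (a + b) (begin
  57          ≡⟨ sym e ⟩
  a + 2 * b   ≡⟨ a+2b≡a+b+b a b ⟩
  a + b + b   ≤⟨ +-monoʳ-≤ (a + b) b≤22 ⟩
  a + b + 22  ∎)
  where open ≤-Reasoning

a+2b≡57⇒a+b≡35⇒ : ∀ {a b} → a + 2 * b ≡ 57 → a + b ≡ 35 → a ≡ 13 × b ≡ 22
a+2b≡57⇒a+b≡35⇒ {a} {b} e a+b≡35 = +-cancelʳ-≡ 22 a 13 (trans (cong (a +_) (sym b≡22)) a+b≡35) , b≡22
  where
    b≡22 : b ≡ 22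
    b≡22 = +-cancelˡ-≡ 35 b 22 (trans (cong (_+ b) (sym a+b≡35)) (trans (sym (a+2b≡a+b+b a b)) e))

-- Decompositions of K₁₉

module OnNineteenVertices (D : List (Block 19)) (decomposition : IsK34Decomposition 19 D) where
  open K34Decomposition D decomposition public

  b₃+2b₄≡57 : b₃ + 2 * b₄ ≡ 57
  b₃+2b₄≡57 = *-cancelˡ-≡ _ 57 6 (+-cancelʳ-≡ 19 _ _ edge-equation)

  2r₃+3r₄≡18 : ∀ v → 2 * r₃ v + 3 * r₄ v ≡ 18
  2r₃+3r₄≡18 v = +-cancelʳ-≡ 1 _ 18 (vertex-equation v)

  σ τ : Fin 19 → ℕ
  σ v = 𝟙 (r₃ v ≟ 0)
  τ v = 𝟙 (1 ≤? r₃ v)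

  s t : ℕ
  s = ∑[ v < 19 ] σ v
  t = ∑[ v < 19 ] τ v

  data Side (v : Fin 19) : Set where
    inS : r₃ v ≡ 0 → σ v ≡ 1 → τ v ≡ 0 → Side v
    inT : 0 < r₃ v → σ v ≡ 0 → τ v ≡ 1 → Side v

  side : ∀ v → Side v
  side v with r₃ v ≟ 0
  ... | yes r₃≡0 = inS r₃≡0 (𝟙-yes (r₃ v ≟ 0) r₃≡0) (𝟙-no (1 ≤? r₃ v) (λ 0<r₃ → <⇒≢ 0<r₃ (sym r₃≡0)))
  ... | no  r₃≢0 = inT (n≢0⇒n>0 r₃≢0) (𝟙-no (r₃ v ≟ 0) r₃≢0) (𝟙-yes (1 ≤? r₃ v) (n≢0⇒n>0 r₃≢0))

  σ+τ≡1 : ∀ v → σ v + τ v ≡ 1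
  σ+τ≡1 v with side v
  ... | inS _ σ≡1 τ≡0 = cong₂ _+_ σ≡1 τ≡0
  ... | inT _ σ≡0 τ≡1 = cong₂ _+_ σ≡0 τ≡1

  s+t≡19 : s + t ≡ 19
  s+t≡19 = trans (sym (∑-distrib-+ σ τ)) (trans (sum-cong-≗ σ+τ≡1) (∑-const 19 1))

  r₄≡6-on-S : ∀ v → r₃ v ≡ 0 → r₄ v ≡ 6
  r₄≡6-on-S v r₃≡0 = from (2x+3y≡18⇒ (2r₃+3r₄≡18 v))
    where
      from : Solution₁₈ (r₃ v) (r₄ v) → r₄ v ≡ 6
      from (inj₁ (_ , r₄≡6))               = r₄≡6
      from (inj₂ (inj₁ (r₃≡3 , _)))        = contradiction (trans (sym r₃≡0) r₃≡3) λ ()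
      from (inj₂ (inj₂ (inj₁ (r₃≡6 , _)))) = contradiction (trans (sym r₃≡0) r₃≡6) λ ()
      from (inj₂ (inj₂ (inj₂ (r₃≡9 , _)))) = contradiction (trans (sym r₃≡0) r₃≡9) λ ()

  r₄≤4-on-T : ∀ v → 0 < r₃ v → r₄ v ≤ 4
  r₄≤4-on-T v 0<r₃ = from (2x+3y≡18⇒ (2r₃+3r₄≡18 v))
    where
      from : Solution₁₈ (r₃ v) (r₄ v) → r₄ v ≤ 4
      from (inj₁ (r₃≡0 , _))               = contradiction (sym r₃≡0) (<⇒≢ 0<r₃)
      from (inj₂ (inj₁ (_ , r₄≡4)))        = ≤-reflexive r₄≡4
      from (inj₂ (inj₂ (inj₁ (_ , r₄≡2)))) = ≤-trans (≤-reflexive r₄≡2) (s≤s (s≤s z≤n))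
      from (inj₂ (inj₂ (inj₂ (_ , r₄≡0)))) = ≤-trans (≤-reflexive r₄≡0) z≤n

  T-profile : ∀ v → 0 < r₃ v → 8 ≤ 3 * r₄ v → r₃ v ≡ 3 × r₄ v ≡ 4
  T-profile v 0<r₃ 8≤3r₄ = from (2x+3y≡18⇒ (2r₃+3r₄≡18 v))
    where
      from : Solution₁₈ (r₃ v) (r₄ v) → r₃ v ≡ 3 × r₄ v ≡ 4
      from (inj₁ (r₃≡0 , _))               = contradiction (sym r₃≡0) (<⇒≢ 0<r₃)
      from (inj₂ (inj₁ r₃≡3×r₄≡4))         = r₃≡3×r₄≡4
      from (inj₂ (inj₂ (inj₁ (_ , r₄≡2)))) = contradiction (subst (λ y → 8 ≤ 3 * y) r₄≡2 8≤3r₄) (<⇒≱ (n≤1+n 7))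
      from (inj₂ (inj₂ (inj₂ (_ , r₄≡0)))) = contradiction (subst (λ y → 8 ≤ 3 * y) r₄≡0 8≤3r₄) λ ()

  r₄≤6σ+4τ : ∀ v → r₄ v ≤ 6 * σ v + 4 * τ v
  r₄≤6σ+4τ v with side v
  ... | inS r₃≡0 σ≡1 τ≡0 rewrite σ≡1 | τ≡0 = ≤-reflexive (r₄≡6-on-S v r₃≡0)
  ... | inT 0<r₃ σ≡0 τ≡1 rewrite σ≡0 | τ≡1 = r₄≤4-on-T v 0<r₃

  4b₄≤6s+4t : 4 * b₄ ≤ 6 * s + 4 * t
  4b₄≤6s+4t = begin
    4 * b₄                           ≡⟨ sym ∑r₄≡4b₄ ⟩
    ∑[ v < 19 ] r₄ v                 ≤⟨ ∑-mono-≤ r₄≤6σ+4τ ⟩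
    ∑[ v < 19 ] (6 * σ v + 4 * τ v)  ≡⟨ ∑-linear 6 4 {g = σ} {h = τ} (λ _ → refl) ⟩
    6 * s + 4 * t                    ∎
    where open ≤-Reasoning

  nS nT : Fin m → ℕ
  nS = weight σ
  nT = weight τ

  triangles-avoid-S : ∀ i → isK3 i * nS i ≡ 0
  triangles-avoid-S = ∑≡0⇒≡0 (λ i → isK3 i * nS i)
                             (trans (double-count isK3 σ) (trans (sum-cong-≗ r₃σ≡0) (∑-zero 19)))
    where
      r₃σ≡0 : ∀ v → r₃ v * σ v ≡ 0
      r₃σ≡0 v with side v
      ... | inS r₃≡0 _ _ = cong (_* σ v) r₃≡0
      ... | inT _ σ≡0 _  = trans (cong (r₃ v *_) σ≡0) (*-zeroʳ (r₃ v))

  nS+nT≡size : ∀ i → nS i + nT i ≡ size i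
  nS+nT≡size i = trans (weight-+ σ τ i) (sum-cong-≗ (λ w → cong (inc i w *_) (σ+τ≡1 w)))

  data BlockType (i : Fin m) : Set where
    triangle : isK3 i ≡ 1 → isK4 i ≡ 0 → nS i ≡ 0 → nT i ≡ 3 → BlockType i
    quad     : isK3 i ≡ 0 → isK4 i ≡ 1 → nS i + nT i ≡ 4 → BlockType i

  blockType : ∀ i → BlockType i
  blockType i with shape i
  ... | triangle k₃ k₄ size≡3 =
    triangle k₃ k₄ nS≡0 (trans (cong (_+ nT i) (sym nS≡0)) (trans (nS+nT≡size i) size≡3))
    where
      nS≡0 : nS i ≡ 0
      nS≡0 = trans (sym (+-identityʳ (nS i))) (subst (λ k → k * nS i ≡ 0) k₃ (triangles-avoid-S i))
  ... | quad     k₃ k₄ size≡4 = quad k₃ k₄ (trans (nS+nT≡size i) size≡4)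

  quad-through-T-has-≤3-S : ∀ i v → τ v ≡ 1 → inc i v * nS i ≤ 3 * (isK4 i * inc i v)
  quad-through-T-has-≤3-S i v τ≡1 with blockType i
  ... | triangle _ _ nS≡0 _ rewrite nS≡0 = ≤-trans (≤-reflexive (*-zeroʳ (inc i v))) z≤n
  ... | quad _ k₄ nS+nT≡4 rewrite k₄ = bound (χ≤1 (block i) v) inc≤nT
    where
      inc≤nT : inc i v ≤ nT i
      inc≤nT = subst (_≤ nT i) (trans (cong (inc i v *_) τ≡1) (*-identityʳ (inc i v)))
                     (term≤∑ (λ w → inc i w * τ w) v)
      bound : ∀ {a} → a ≤ 1 → a ≤ nT i → a * nS i ≤ 3 * (1 * a)
      bound z≤n       _    = z≤n
      bound (s≤s z≤n) 1≤nT = ≤-trans (≤-reflexive (+-identityʳ (nS i)))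
                               (+-cancelʳ-≤ 1 (nS i) 3 (≤-trans (+-monoʳ-≤ (nS i) 1≤nT) (≤-reflexive nS+nT≡4)))

  s≤3r₄-on-T : ∀ v → σ v ≡ 0 → τ v ≡ 1 → s ≤ 3 * r₄ v
  s≤3r₄-on-T v σ≡0 τ≡1 = begin
    s                                    ≡⟨ sym (trans (cong (s +_) (*-zeroʳ (deg v))) (+-identityʳ s)) ⟩
    s + deg v * 0                        ≡⟨ cong (λ k → s + deg v * k) (sym σ≡0) ⟩
    s + deg v * σ v                      ≡⟨ sym (neighbourhood-sum once v σ) ⟩
    ∑[ i < m ] (inc i v * nS i) + σ v    ≡⟨ trans (cong (∑[ i < m ] (inc i v * nS i) +_) σ≡0) (+-identityʳ _) ⟩
    ∑[ i < m ] (inc i v * nS i)          ≤⟨ ∑-mono-≤ (λ i → quad-through-T-has-≤3-S i v τ≡1) ⟩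
    ∑[ i < m ] (3 * (isK4 i * inc i v))  ≡⟨ sym (*-distribˡ-sum 3 (λ i → isK4 i * inc i v)) ⟩
    3 * r₄ v                             ∎
    where open ≤-Reasoning

  module AtLeast23K4s (23≤b₄ : 23 ≤ b₄) where

    8≤s : 8 ≤ s
    8≤s = *-cancelˡ-≤ 2 (+-cancelˡ-≤ 76 _ _ (begin
      92                   ≤⟨ *-monoʳ-≤ 4 23≤b₄ ⟩
      4 * b₄               ≤⟨ 4b₄≤6s+4t ⟩
      6 * s + 4 * t        ≡⟨ regroup s t ⟩
      4 * (s + t) + 2 * s  ≡⟨ cong (λ k → 4 * k + 2 * s) s+t≡19 ⟩
      76 + 2 * s           ∎))
      where
        open ≤-Reasoning
        regroup : ∀ s t → 6 * s + 4 * t ≡ 4 * (s + t) + 2 * s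
        regroup = solve-∀

    data VertexClass (v : Fin 19) : Set where
      S-vertex : σ v ≡ 1 → τ v ≡ 0 → r₃ v ≡ 0 → r₄ v ≡ 6 → VertexClass v
      T-vertex : σ v ≡ 0 → τ v ≡ 1 → r₃ v ≡ 3 → r₄ v ≡ 4 → VertexClass v

    classify : ∀ v → VertexClass v
    classify v with side v
    ... | inS r₃≡0 σ≡1 τ≡0 = S-vertex σ≡1 τ≡0 r₃≡0 (r₄≡6-on-S v r₃≡0)
    ... | inT 0<r₃ σ≡0 τ≡1 = T-vertex σ≡0 τ≡1 (proj₁ profile) (proj₂ profile)
      where
        profile : r₃ v ≡ 3 × r₄ v ≡ 4
        profile = T-profile v 0<r₃ (≤-trans 8≤s (s≤3r₄-on-T v σ≡0 τ≡1))

    4b₄≡6s+4t : 4 * b₄ ≡ 6 * s + 4 * t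
    4b₄≡6s+4t = trans (sym ∑r₄≡4b₄) (∑-linear 6 4 {g = σ} {h = τ} r₄≡6σ+4τ)
      where
        r₄≡6σ+4τ : ∀ v → r₄ v ≡ 6 * σ v + 4 * τ v
        r₄≡6σ+4τ v with classify v
        ... | S-vertex σ≡1 τ≡0 _ r₄≡6 rewrite σ≡1 | τ≡0 = r₄≡6
        ... | T-vertex σ≡0 τ≡1 _ r₄≡4 rewrite σ≡0 | τ≡1 = r₄≡4

    b₃≡t : b₃ ≡ t
    b₃≡t = *-cancelˡ-≡ b₃ t 3 (trans (sym ∑r₃≡3b₃) (trans (sum-cong-≗ r₃≡3τ) (sym (*-distribˡ-sum 3 τ))))
      where
        r₃≡3τ : ∀ v → r₃ v ≡ 3 * τ v
        r₃≡3τ v with classify v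
        ... | S-vertex _ τ≡0 r₃≡0 _ rewrite τ≡0 = r₃≡0
        ... | T-vertex _ τ≡1 r₃≡3 _ rewrite τ≡1 = r₃≡3

    0<t : 0 < t
    0<t = n≢0⇒n>0 λ t≡0 → even≢odd b₄ 28 (subst (λ k → k + 2 * b₄ ≡ 57) (trans b₃≡t t≡0) b₃+2b₄≡57)

    s≤12 : s ≤ 12
    s≤12 = bound (∑>0⇒∃>0 τ 0<t)
      where
        bound : (∃ λ v → 0 < τ v) → s ≤ 12
        bound (v , 0<τ) with classify v
        ... | S-vertex _ τ≡0 _ _      = contradiction (subst (0 <_) τ≡0 0<τ) λ ()
        ... | T-vertex σ≡0 τ≡1 _ r₄≡4 = subst (λ k → s ≤ 3 * k) r₄≡4 (s≤3r₄-on-T v σ≡0 τ≡1)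

    deg≡7-on-T : ∀ v → τ v ≡ 1 → deg v ≡ 7
    deg≡7-on-T v τ≡1 with classify v
    ... | S-vertex _ τ≡0 _ _     = contradiction (trans (sym τ≡0) τ≡1) λ ()
    ... | T-vertex _ _ r₃≡3 r₄≡4 = trans (deg≡r₃+r₄ v) (cong₂ _+_ r₃≡3 r₄≡4)

    T-around : Fin 19 → ℕ
    T-around v = ∑[ i < m ] (inc i v * nT i)

    T-around-S : ∀ v → τ v ≡ 0 → T-around v ≡ t
    T-around-S v τ≡0 = begin
      T-around v        ≡⟨ sym (+-identityʳ (T-around v)) ⟩
      T-around v + 0    ≡⟨ cong (T-around v +_) (sym τ≡0) ⟩
      T-around v + τ v  ≡⟨ neighbourhood-sum once v τ ⟩
      t + deg v * τ v   ≡⟨ cong (λ k → t + deg v * k) τ≡0 ⟩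
      t + deg v * 0     ≡⟨ trans (cong (t +_) (*-zeroʳ (deg v))) (+-identityʳ t) ⟩
      t                 ∎
      where open ≡-Reasoning

    T-around-T : ∀ v → τ v ≡ 1 → T-around v ≡ t + 6
    T-around-T v τ≡1 = +-cancelʳ-≡ 1 _ _ (begin
      T-around v + 1    ≡⟨ cong (T-around v +_) (sym τ≡1) ⟩
      T-around v + τ v  ≡⟨ neighbourhood-sum once v τ ⟩
      t + deg v * τ v   ≡⟨ cong₂ (λ d k → t + d * k) (deg≡7-on-T v τ≡1) τ≡1 ⟩
      t + 7             ≡⟨ sym (+-assoc t 6 1) ⟩
      t + 6 + 1         ∎)
      where open ≡-Reasoning

    ∑nT≡7t : ∑[ i < m ] nT i ≡ 7 * t
    ∑nT≡7t = begin
      ∑[ i < m ] nT i            ≡⟨ sum-cong-≗ (λ i → sym (*-identityˡ (nT i))) ⟩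
      ∑[ i < m ] (1 * nT i)      ≡⟨ double-count (λ _ → 1) τ ⟩
      ∑[ w < 19 ] (deg w * τ w)  ≡⟨ sum-cong-≗ degτ≡7τ ⟩
      ∑[ w < 19 ] (7 * τ w)      ≡⟨ sym (*-distribˡ-sum 7 τ) ⟩
      7 * t                      ∎
      where
        open ≡-Reasoning
        degτ≡7τ : ∀ w → deg w * τ w ≡ 7 * τ w
        degτ≡7τ w with classify w
        ... | S-vertex _ τ≡0 _ _ rewrite τ≡0 = *-zeroʳ (deg w)
        ... | T-vertex _ τ≡1 _ _ rewrite τ≡1 = cong (_* 1) (deg≡7-on-T w τ≡1)

    ∑nT²≡[t+6]t : ∑[ i < m ] (nT i * nT i) ≡ (t + 6) * t
    ∑nT²≡[t+6]t = begin
      ∑[ i < m ] (nT i * nT i)          ≡⟨ double-count nT τ ⟩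
      ∑[ w < 19 ] (through nT w * τ w)  ≡⟨ sum-cong-≗ aroundτ ⟩
      ∑[ w < 19 ] ((t + 6) * τ w)       ≡⟨ sym (*-distribˡ-sum (t + 6) τ) ⟩
      (t + 6) * t                       ∎
      where
        open ≡-Reasoning
        aroundτ : ∀ w → through nT w * τ w ≡ (t + 6) * τ w
        aroundτ w with classify w
        ... | S-vertex _ τ≡0 _ _ rewrite τ≡0 = trans (*-zeroʳ (through nT w)) (sym (*-zeroʳ (t + 6)))
        ... | T-vertex _ τ≡1 _ _ rewrite τ≡1 =
          cong (_* 1) (trans (sum-cong-≗ (λ i → *-comm (nT i) (inc i w))) (T-around-T w τ≡1))

    ∑₄ : (ℕ → ℕ) → ℕ
    ∑₄ f = ∑[ i < m ] (isK4 i * f (nT i))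

    ∑₄+triangles : ∀ f → ∑₄ f + f 3 * t ≡ ∑[ i < m ] f (nT i)
    ∑₄+triangles f = begin
      ∑₄ f + f 3 * t                                  ≡⟨ cong (λ k → ∑₄ f + f 3 * k) (sym b₃≡t) ⟩
      ∑₄ f + f 3 * b₃                                 ≡⟨ cong (∑₄ f +_) (*-distribˡ-sum (f 3) isK3) ⟩
      ∑₄ f + ∑[ i < m ] (f 3 * isK3 i)                ≡⟨ sym (∑-distrib-+ (λ i → isK4 i * f (nT i)) _) ⟩
      ∑[ i < m ] (isK4 i * f (nT i) + f 3 * isK3 i)   ≡⟨ sum-cong-≗ by-type ⟩
      ∑[ i < m ] f (nT i)                             ∎
      where
        open ≡-Reasoning
        by-type : ∀ i → isK4 i * f (nT i) + f 3 * isK3 i ≡ f (nT i)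
        by-type i with blockType i
        ... | triangle k₃ k₄ _ nT≡3 rewrite k₃ | k₄ | nT≡3 = *-identityʳ (f 3)
        ... | quad     k₃ k₄ _      rewrite k₃ | k₄        =
          trans (cong₂ _+_ (*-identityˡ (f (nT i))) (*-zeroʳ (f 3))) (+-identityʳ (f (nT i)))

    ∑₄1≡b₄ : ∑₄ (λ _ → 1) ≡ b₄
    ∑₄1≡b₄ = sum-cong-≗ (λ i → *-identityʳ (isK4 i))

    ∑₄j+3t≡7t : ∑₄ (λ j → j) + 3 * t ≡ 7 * t
    ∑₄j+3t≡7t = trans (∑₄+triangles (λ j → j)) ∑nT≡7t

    ∑₄j²+9t≡[t+6]t : ∑₄ (λ j → j * j) + 9 * t ≡ (t + 6) * t
    ∑₄j²+9t≡[t+6]t = trans (∑₄+triangles (λ j → j * j)) ∑nT²≡[t+6]t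

    3∑₄j≤∑₄j²+2b₄ : 3 * ∑₄ (λ j → j) ≤ ∑₄ (λ j → j * j) + 2 * b₄
    3∑₄j≤∑₄j²+2b₄ = begin
      3 * ∑₄ (λ j → j)                                ≡⟨ *-distribˡ-sum 3 (λ i → isK4 i * nT i) ⟩
      ∑[ i < m ] (3 * (isK4 i * nT i))                ≤⟨ ∑-mono-≤ (λ i → per-quad (isK4 i) (nT i)) ⟩
      ∑[ i < m ] (isK4 i * (nT i * nT i) + 2 * isK4 i) ≡⟨ ∑-distrib-+ (λ i → isK4 i * (nT i * nT i)) _ ⟩
      ∑₄ (λ j → j * j) + ∑[ i < m ] (2 * isK4 i)      ≡⟨ cong (∑₄ (λ j → j * j) +_) (sym (*-distribˡ-sum 2 isK4)) ⟩
      ∑₄ (λ j → j * j) + 2 * b₄                       ∎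
      where
        open ≤-Reasoning
        per-quad : ∀ k j → 3 * (k * j) ≤ k * (j * j) + 2 * k
        per-quad k j = begin
          3 * (k * j)          ≡⟨ regroup₁ k j ⟩
          k * (3 * j)          ≤⟨ *-monoʳ-≤ k (3j≤j*j+2 j) ⟩
          k * (j * j + 2)      ≡⟨ regroup₂ k j ⟩
          k * (j * j) + 2 * k  ∎
          where regroup₁ : ∀ k j → 3 * (k * j) ≡ k * (3 * j)
                regroup₁ = solve-∀
                regroup₂ : ∀ k j → k * (j * j + 2) ≡ k * (j * j) + 2 * k
                regroup₂ = solve-∀

    42t≤2[t+6]t+6s+4t : 42 * t ≤ 2 * ((t + 6) * t) + (6 * s + 4 * t)
    42t≤2[t+6]t+6s+4t = begin
      42 * t                                    ≡⟨ *-assoc 6 7 t ⟩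
      6 * (7 * t)                               ≡⟨ cong (6 *_) (sym ∑₄j+3t≡7t) ⟩
      6 * (∑₄ (λ j → j) + 3 * t)                ≡⟨ regroup₁ (∑₄ (λ j → j)) t ⟩
      2 * (3 * ∑₄ (λ j → j)) + 18 * t           ≤⟨ +-monoˡ-≤ (18 * t) (*-monoʳ-≤ 2 3∑₄j≤∑₄j²+2b₄) ⟩
      2 * (∑₄ (λ j → j * j) + 2 * b₄) + 18 * t  ≡⟨ regroup₂ (∑₄ (λ j → j * j)) b₄ t ⟩
      2 * (∑₄ (λ j → j * j) + 9 * t) + 4 * b₄   ≡⟨ cong₂ (λ p q → 2 * p + q) ∑₄j²+9t≡[t+6]t 4b₄≡6s+4t ⟩
      2 * ((t + 6) * t) + (6 * s + 4 * t)       ∎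
      where
        open ≤-Reasoning
        regroup₁ : ∀ q t → 6 * (q + 3 * t) ≡ 2 * (3 * q) + 18 * t
        regroup₁ = solve-∀
        regroup₂ : ∀ p b t → 2 * (p + 2 * b) + 18 * t ≡ 2 * (p + 9 * t) + 4 * b
        regroup₂ = solve-∀

    s≡8 : s ≡ 8
    s≡8 = s≡8-forced s+t≡19 8≤s s≤12 42t≤2[t+6]t+6s+4t

    t≡11 : t ≡ 11
    t≡11 = +-cancelˡ-≡ 8 t 11 (trans (cong (_+ t) (sym s≡8)) s+t≡19)

    b₄≡23 : b₄ ≡ 23
    b₄≡23 = *-cancelˡ-≡ b₄ 23 4 (trans 4b₄≡6s+4t (cong₂ (λ p q → 6 * p + 4 * q) s≡8 t≡11))

    ∑₄j≡44 : ∑₄ (λ j → j) ≡ 44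
    ∑₄j≡44 = +-cancelʳ-≡ 33 _ 44 (trans (cong (λ k → ∑₄ (λ j → j) + 3 * k) (sym t≡11))
                                     (trans ∑₄j+3t≡7t (cong (7 *_) t≡11)))

    ∑₄j²≡88 : ∑₄ (λ j → j * j) ≡ 88
    ∑₄j²≡88 = +-cancelʳ-≡ 99 _ 88 (trans (cong (λ k → ∑₄ (λ j → j * j) + 9 * k) (sym t≡11))
                                      (trans ∑₄j²+9t≡[t+6]t (cong (λ k → (k + 6) * k) t≡11)))

    ofType : ℕ → Fin m → ℕ
    ofType k i = isK4 i * 𝟙 (nT i ≟ k)

    typeCount : ℕ → ℕ
    typeCount k = sum (ofType k)

    expand : ∀ (w : Fin m → ℕ) f →
             ∑[ i < m ] (isK4 i * f (nT i) * w i) ≡ ∑[ k < 5 ] (f (toℕ k) * ∑[ i < m ] (ofType (toℕ k) i * w i))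
    expand w f = begin
      ∑[ i < m ] (isK4 i * f (nT i) * w i)
        ≡⟨ sum-cong-≗ by-type ⟩
      ∑[ i < m ] ∑[ k < 5 ] (f (toℕ k) * (ofType (toℕ k) i * w i))
        ≡⟨ ∑-comm {m} {5} (λ i k → f (toℕ k) * (ofType (toℕ k) i * w i)) ⟩
      ∑[ k < 5 ] ∑[ i < m ] (f (toℕ k) * (ofType (toℕ k) i * w i))
        ≡⟨ sum-cong-≗ {5} (λ k → sym (*-distribˡ-sum (f (toℕ k)) (λ i → ofType (toℕ k) i * w i))) ⟩
      ∑[ k < 5 ] (f (toℕ k) * ∑[ i < m ] (ofType (toℕ k) i * w i))
        ∎
      where
        open ≡-Reasoning
        by-type : ∀ i → isK4 i * f (nT i) * w i ≡ ∑[ k < 5 ] (f (toℕ k) * (ofType (toℕ k) i * w i))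
        by-type i with blockType i
        ... | triangle _ k₄ _ _ rewrite k₄ = sym (trans (sum-cong-≗ {5} (λ k → *-zeroʳ (f (toℕ k)))) (∑-zero 5))
        ... | quad     _ k₄ nS+nT≡4 rewrite k₄ = begin
          1 * f (nT i) * w i
            ≡⟨ cong (_* w i) (*-identityˡ (f (nT i))) ⟩
          f (nT i) * w i
            ≡⟨ cong (_* w i) (sym (∑-δℕ {5} (nT i) nT<5 f)) ⟩
          ∑[ k < 5 ] (𝟙 (nT i ≟ toℕ k) * f (toℕ k)) * w i
            ≡⟨ *-distribʳ-sum {5} (w i) (λ k → 𝟙 (nT i ≟ toℕ k) * f (toℕ k)) ⟩
          ∑[ k < 5 ] (𝟙 (nT i ≟ toℕ k) * f (toℕ k) * w i)
            ≡⟨ sum-cong-≗ {5} (λ k → regroup (𝟙 (nT i ≟ toℕ k)) (f (toℕ k)) (w i)) ⟩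
          ∑[ k < 5 ] (f (toℕ k) * (1 * 𝟙 (nT i ≟ toℕ k) * w i))
            ∎
          where
            nT<5 : nT i < 5
            nT<5 = s≤s (subst (nT i ≤_) nS+nT≡4 (m≤n+m (nT i) (nS i)))
            regroup : ∀ d x y → d * x * y ≡ x * (1 * d * y)
            regroup = solve-∀

    moment-typeCount : ∀ f → ∑₄ f ≡ moment typeCount f
    moment-typeCount f = begin
      ∑₄ f
        ≡⟨ sum-cong-≗ (λ i → sym (*-identityʳ (isK4 i * f (nT i)))) ⟩
      ∑[ i < m ] (isK4 i * f (nT i) * 1)
        ≡⟨ expand (λ _ → 1) f ⟩
      ∑[ k < 5 ] (f (toℕ k) * ∑[ i < m ] (ofType (toℕ k) i * 1))
        ≡⟨ sum-cong-≗ {5} (λ k → cong (f (toℕ k) *_) (sum-cong-≗ (λ i → *-identityʳ (ofType (toℕ k) i)))) ⟩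
      moment typeCount f
        ∎
      where open ≡-Reasoning

    quad-nS≡4∸nT : ∀ i → nS i + nT i ≡ 4 → nS i ≡ 4 ∸ nT i
    quad-nS≡4∸nT i nS+nT≡4 = trans (sym (m+n∸n≡m (nS i) (nT i))) (cong (_∸ nT i) nS+nT≡4)

    odd-block-at-S : ∀ w → τ w ≡ 0 → 0 < through (λ i → nT i % 2) w
    odd-block-at-S w τ≡0 = n≢0⇒n>0 λ odd≡0 → even≢odd (through (λ i → nT i / 2) w) 5 (sym (begin
      11
        ≡⟨ sym t≡11 ⟩
      t
        ≡⟨ sym (T-around-S w τ≡0) ⟩
      T-around w
        ≡⟨ ∑-linear 1 2 halves ⟩
      1 * through (λ i → nT i % 2) w + 2 * through (λ i → nT i / 2) w
        ≡⟨ cong (λ k → 1 * k + 2 * through (λ i → nT i / 2) w) odd≡0 ⟩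
      2 * through (λ i → nT i / 2) w
        ∎))
      where
        open ≡-Reasoning
        halves : ∀ i → inc i w * nT i ≡ 1 * (nT i % 2 * inc i w) + 2 * (nT i / 2 * inc i w)
        halves i = trans (cong (inc i w *_) (m≡m%n+[m/n]*n (nT i) 2)) (regroup (inc i w) (nT i % 2) (nT i / 2))
          where regroup : ∀ x r q → x * (r + q * 2) ≡ 1 * (r * x) + 2 * (q * x)
                regroup = solve-∀

    odd-moment≥8 : 8 ≤ moment typeCount (λ k → k % 2 * (4 ∸ k))
    odd-moment≥8 = begin
      8                                               ≡⟨ sym s≡8 ⟩
      s                                               ≤⟨ ∑-mono-≤ σ≤oddσ ⟩
      ∑[ w < 19 ] (through (λ i → nT i % 2) w * σ w)  ≡⟨ sym (double-count (λ i → nT i % 2) σ) ⟩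
      ∑[ i < m ] (nT i % 2 * nS i)                    ≡⟨ sum-cong-≗ by-type ⟩
      ∑₄ (λ j → j % 2 * (4 ∸ j))                      ≡⟨ moment-typeCount (λ j → j % 2 * (4 ∸ j)) ⟩
      moment typeCount (λ k → k % 2 * (4 ∸ k))        ∎
      where
        open ≤-Reasoning
        σ≤oddσ : ∀ w → σ w ≤ through (λ i → nT i % 2) w * σ w
        σ≤oddσ w with classify w
        ... | S-vertex σ≡1 τ≡0 _ _ rewrite σ≡1 = subst (1 ≤_) (sym (*-identityʳ _)) (odd-block-at-S w τ≡0)
        ... | T-vertex σ≡0 _ _ _   rewrite σ≡0 = z≤n
        by-type : ∀ i → nT i % 2 * nS i ≡ isK4 i * (nT i % 2 * (4 ∸ nT i))
        by-type i with blockType i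
        ... | triangle _ k₄ nS≡0 _ rewrite k₄ | nS≡0 = *-zeroʳ (nT i % 2)
        ... | quad     _ k₄ nS+nT≡4 rewrite k₄ =
          trans (cong (nT i % 2 *_) (quad-nS≡4∸nT i nS+nT≡4)) (sym (*-identityˡ _))

    typeCount₀₃₄ : typeCount 0 ≡ 0 × typeCount 3 ≡ 1 × typeCount 4 ≡ 0
    typeCount₀₃₄ = type-counts typeCount
      (trans (sym (moment-typeCount (λ _ → 1))) (trans ∑₄1≡b₄ b₄≡23))
      (trans (sym (moment-typeCount (λ j → j))) ∑₄j≡44)
      (trans (sym (moment-typeCount (λ j → j * j))) ∑₄j²≡88)
      odd-moment≥8

    ρ : ℕ → Fin 19 → ℕ
    ρ k = through (ofType k)

    ρ≡0 : ∀ k → typeCount k ≡ 0 → ∀ v → ρ k v ≡ 0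
    ρ≡0 k typeCount≡0 v =
      trans (sum-cong-≗ (λ i → cong (_* inc i v) (∑≡0⇒≡0 (ofType k) typeCount≡0 i))) (∑-zero m)

    r₄≡moment : ∀ v → r₄ v ≡ moment (λ k → ρ k v) (λ _ → 1)
    r₄≡moment v = trans (sum-cong-≗ (λ i → cong (_* inc i v) (sym (*-identityʳ (isK4 i)))))
                        (expand (λ i → inc i v) (λ _ → 1))

    T-around≡3r₃+moment : ∀ v → T-around v ≡ 3 * r₃ v + moment (λ k → ρ k v) (λ j → j)
    T-around≡3r₃+moment v = begin
      T-around v
        ≡⟨ sum-cong-≗ by-type ⟩
      ∑[ i < m ] (3 * (isK3 i * inc i v) + isK4 i * nT i * inc i v)
        ≡⟨ ∑-distrib-+ (λ i → 3 * (isK3 i * inc i v)) _ ⟩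
      ∑[ i < m ] (3 * (isK3 i * inc i v)) + ∑[ i < m ] (isK4 i * nT i * inc i v)
        ≡⟨ cong₂ _+_ (sym (*-distribˡ-sum 3 (λ i → isK3 i * inc i v))) (expand (λ i → inc i v) (λ j → j)) ⟩
      3 * r₃ v + moment (λ k → ρ k v) (λ j → j)
        ∎
      where
        open ≡-Reasoning
        by-type : ∀ i → inc i v * nT i ≡ 3 * (isK3 i * inc i v) + isK4 i * nT i * inc i v
        by-type i with blockType i
        ... | triangle k₃ k₄ _ nT≡3 rewrite k₃ | k₄ | nT≡3 = on-triangle (inc i v)
          where on-triangle : ∀ x → x * 3 ≡ 3 * (1 * x) + 0 * 3 * x
                on-triangle = solve-∀
        ... | quad     k₃ k₄ _      rewrite k₃ | k₄        = on-quad (inc i v) (nT i)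
          where on-quad : ∀ x j → x * j ≡ 3 * (0 * x) + 1 * j * x
                on-quad = solve-∀

    balance : ∀ v → 2 * r₄ v + ρ 3 v + 3 * r₃ v ≡ T-around v + ρ 1 v
    balance v = begin
      2 * r₄ v + ρ 3 v + 3 * r₃ v
        ≡⟨ cong (λ r → 2 * r + ρ 3 v + 3 * r₃ v) (r₄≡moment v) ⟩
      2 * moment (λ k → ρ k v) (λ _ → 1) + ρ 3 v + 3 * r₃ v
        ≡⟨ cong (_+ 3 * r₃ v) (moment-balance (λ k → ρ k v) (ρ≡0 0 typeCount₀≡0 v) (ρ≡0 4 typeCount₄≡0 v)) ⟩
      moment (λ k → ρ k v) (λ j → j) + ρ 1 v + 3 * r₃ v
        ≡⟨ regroup (moment (λ k → ρ k v) (λ j → j)) (ρ 1 v) (r₃ v) ⟩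
      3 * r₃ v + moment (λ k → ρ k v) (λ j → j) + ρ 1 v
        ≡⟨ cong (_+ ρ 1 v) (sym (T-around≡3r₃+moment v)) ⟩
      T-around v + ρ 1 v
        ∎
      where
        open ≡-Reasoning
        typeCount₀≡0 : typeCount 0 ≡ 0
        typeCount₀≡0 = proj₁ typeCount₀₃₄
        typeCount₄≡0 : typeCount 4 ≡ 0
        typeCount₄≡0 = proj₂ (proj₂ typeCount₀₃₄)
        regroup : ∀ p q r → p + q + 3 * r ≡ 3 * r + p + q
        regroup = solve-∀

    ρ₁≡1+ρ₃-on-S : ∀ v → τ v ≡ 0 → r₃ v ≡ 0 → r₄ v ≡ 6 → ρ 1 v ≡ suc (ρ 3 v)
    ρ₁≡1+ρ₃-on-S v τ≡0 r₃≡0 r₄≡6 = sym (+-cancelˡ-≡ 11 _ _ (begin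
      11 + suc (ρ 3 v)             ≡⟨ sym (+-identityʳ _) ⟩
      12 + ρ 3 v + 0               ≡⟨ cong₂ (λ p q → 2 * p + ρ 3 v + 3 * q) (sym r₄≡6) (sym r₃≡0) ⟩
      2 * r₄ v + ρ 3 v + 3 * r₃ v  ≡⟨ balance v ⟩
      T-around v + ρ 1 v           ≡⟨ cong (_+ ρ 1 v) (trans (T-around-S v τ≡0) t≡11) ⟩
      11 + ρ 1 v                   ∎))
      where open ≡-Reasoning

    ρ₁≡ρ₃-on-T : ∀ v → τ v ≡ 1 → r₃ v ≡ 3 → r₄ v ≡ 4 → ρ 1 v ≡ ρ 3 v
    ρ₁≡ρ₃-on-T v τ≡1 r₃≡3 r₄≡4 = sym (+-cancelˡ-≡ 17 _ _ (begin
      17 + ρ 3 v                   ≡⟨ regroup (ρ 3 v) ⟩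
      8 + ρ 3 v + 9                ≡⟨ cong₂ (λ p q → 2 * p + ρ 3 v + 3 * q) (sym r₄≡4) (sym r₃≡3) ⟩
      2 * r₄ v + ρ 3 v + 3 * r₃ v  ≡⟨ balance v ⟩
      T-around v + ρ 1 v           ≡⟨ cong (_+ ρ 1 v) (trans (T-around-T v τ≡1) (cong (_+ 6) t≡11)) ⟩
      17 + ρ 1 v                   ∎))
      where
        open ≡-Reasoning
        regroup : ∀ r → 17 + r ≡ 8 + r + 9
        regroup = solve-∀

    ofType≤1 : ∀ k i → ofType k i ≤ 1
    ofType≤1 k i = *-mono-≤ {y = 1} {v = 1} (𝟙≤1 (length (block i) ≟ 4)) (𝟙≤1 (nT i ≟ k))

    ofType₁+ofType₃≤1 : ∀ i → ofType 1 i + ofType 3 i ≤ 1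
    ofType₁+ofType₃≤1 i = begin
      ofType 1 i + ofType 3 i                  ≡⟨ sym (*-distribˡ-+ (isK4 i) (𝟙 (nT i ≟ 1)) (𝟙 (nT i ≟ 3))) ⟩
      isK4 i * (𝟙 (nT i ≟ 1) + 𝟙 (nT i ≟ 3))  ≤⟨ *-mono-≤ {y = 1} {v = 1} (𝟙≤1 (length (block i) ≟ 4))
                                                                       (𝟙≟1+𝟙≟3≤1 (nT i)) ⟩
      1                                        ∎
      where open ≤-Reasoning

    ofType-fixes-nT : ∀ k i (f : ℕ → ℕ) → ofType k i * f (nT i) ≡ ofType k i * f k
    ofType-fixes-nT k i f = begin
      isK4 i * 𝟙 (nT i ≟ k) * f (nT i)    ≡⟨ *-assoc (isK4 i) _ _ ⟩
      isK4 i * (𝟙 (nT i ≟ k) * f (nT i))  ≡⟨ cong (isK4 i *_) (𝟙-≟-subst (nT i) k f) ⟩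
      isK4 i * (𝟙 (nT i ≟ k) * f k)       ≡⟨ sym (*-assoc (isK4 i) _ _) ⟩
      isK4 i * 𝟙 (nT i ≟ k) * f k         ∎
      where open ≡-Reasoning

    ofType₃·nS≡ofType₃ : ∀ i → ofType 3 i * nS i ≡ ofType 3 i
    ofType₃·nS≡ofType₃ i with blockType i
    ... | triangle _ k₄ _ _ rewrite k₄ = refl
    ... | quad _ _ nS+nT≡4 = trans (cong (ofType 3 i *_) (quad-nS≡4∸nT i nS+nT≡4))
                                   (trans (ofType-fixes-nT 3 i (4 ∸_)) (*-identityʳ (ofType 3 i)))

    S-vertex-on-type-3 : ∃ λ z → σ z ≡ 1 × τ z ≡ 0 × r₃ z ≡ 0 × r₄ z ≡ 6 × 0 < ρ 3 z
    S-vertex-on-type-3 = pick (∑>0⇒∃>0 (λ w → ρ 3 w * σ w) (≤-reflexive (sym ∑ρ₃σ≡1)))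
      where
        ∑ρ₃σ≡1 : ∑[ w < 19 ] (ρ 3 w * σ w) ≡ 1
        ∑ρ₃σ≡1 = trans (sym (double-count (ofType 3) σ))
                       (trans (sum-cong-≗ ofType₃·nS≡ofType₃) (proj₁ (proj₂ typeCount₀₃₄)))
        pick : (∃ λ z → 0 < ρ 3 z * σ z) → ∃ λ z → σ z ≡ 1 × τ z ≡ 0 × r₃ z ≡ 0 × r₄ z ≡ 6 × 0 < ρ 3 z
        pick (z , 0<ρσ) with classify z
        ... | S-vertex σ≡1 τ≡0 r₃≡0 r₄≡6 =
          z , σ≡1 , τ≡0 , r₃≡0 , r₄≡6 , subst (0 <_) (trans (cong (ρ 3 z *_) σ≡1) (*-identityʳ (ρ 3 z))) 0<ρσ
        ... | T-vertex σ≡0 _ _ _ =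
          contradiction (subst (0 <_) (trans (cong (ρ 3 z *_) σ≡0) (*-zeroʳ (ρ 3 z))) 0<ρσ) λ ()

    T-partner : ∀ z → 0 < ρ 1 z →
                ∃ λ u → τ u ≡ 1 × r₃ u ≡ 3 × r₄ u ≡ 4 × 0 < ∑[ i < m ] (ofType 1 i * inc i z * inc i u)
    T-partner z 0<ρ₁ = pick (∑>0⇒∃>0 (λ u → shared u * τ u) (subst (0 <_) ρ₁≡∑shared·τ 0<ρ₁))
      where
        shared : Fin 19 → ℕ
        shared = through (λ i → ofType 1 i * inc i z)
        one-T : ∀ i → ofType 1 i * inc i z * nT i ≡ ofType 1 i * inc i z
        one-T i = begin
          ofType 1 i * inc i z * nT i  ≡⟨ swap (ofType 1 i) (inc i z) (nT i) ⟩
          ofType 1 i * nT i * inc i z  ≡⟨ cong (_* inc i z) (ofType-fixes-nT 1 i (λ j → j)) ⟩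
          ofType 1 i * 1 * inc i z     ≡⟨ cong (_* inc i z) (*-identityʳ (ofType 1 i)) ⟩
          ofType 1 i * inc i z         ∎
          where
            open ≡-Reasoning
            swap : ∀ a b c → a * b * c ≡ a * c * b
            swap = solve-∀
        ρ₁≡∑shared·τ : ρ 1 z ≡ ∑[ u < 19 ] (shared u * τ u)
        ρ₁≡∑shared·τ = trans (sum-cong-≗ (sym ∘ one-T)) (double-count (λ i → ofType 1 i * inc i z) τ)
        pick : (∃ λ u → 0 < shared u * τ u) →
               ∃ λ u → τ u ≡ 1 × r₃ u ≡ 3 × r₄ u ≡ 4 × 0 < ∑[ i < m ] (ofType 1 i * inc i z * inc i u)
        pick (u , 0<shared·τ) with classify u
        ... | S-vertex _ τ≡0 _ _ =
          contradiction (subst (0 <_) (trans (cong (shared u *_) τ≡0) (*-zeroʳ (shared u))) 0<shared·τ) λ ()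
        ... | T-vertex _ τ≡1 r₃≡3 r₄≡4 =
          u , τ≡1 , r₃≡3 , r₄≡4 , subst (0 <_) (trans (cong (shared u *_) τ≡1) (*-identityʳ (shared u))) 0<shared·τ

    shared≤ρ : ∀ k z u → ∑[ i < m ] (ofType k i * inc i z * inc i u) ≤ ρ k u
    shared≤ρ k z u = ∑-mono-≤ λ i →
      ≤-trans (*-monoˡ-≤ (inc i u) (*-monoʳ-≤ (ofType k i) (χ≤1 (block i) z)))
              (≤-reflexive (cong (_* inc i u) (*-identityʳ (ofType k i))))

    type-1-and-type-3-block-in-common :
      ∃ λ z → ∃ λ u → z ≢ u × 0 < ∑[ i < m ] (ofType 1 i * inc i z * inc i u)
                            × 0 < ∑[ i < m ] (ofType 3 i * inc i z * inc i u)
    type-1-and-type-3-block-in-common =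
      let (z , σz≡1 , τz≡0 , r₃z≡0 , r₄z≡6 , 0<ρ₃z) = S-vertex-on-type-3
          (u , τu≡1 , r₃u≡3 , r₄u≡4 , 0<shared₁) =
            T-partner z (subst (0 <_) (sym (ρ₁≡1+ρ₃-on-S z τz≡0 r₃z≡0 r₄z≡6)) (s≤s z≤n))
          0<ρ₃u = subst (0 <_) (ρ₁≡ρ₃-on-T u τu≡1 r₃u≡3 r₄u≡4) (≤-trans 0<shared₁ (shared≤ρ 1 z u))
          z≢u : z ≢ u
          z≢u z≡u = contradiction (trans (sym (σ+τ≡1 u)) (cong₂ _+_ (subst (λ w → σ w ≡ 1) z≡u σz≡1) τu≡1)) λ ()
      in z , u , z≢u , 0<shared₁ ,
         common-block (ofType≤1 3) (≤-reflexive (proj₁ (proj₂ typeCount₀₃₄))) 0<ρ₃z 0<ρ₃u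

    absurd : ⊥
    absurd =
      let (z , u , z≢u , 0<shared₁ , 0<shared₃) = type-1-and-type-3-block-in-common
      in <⇒≱ (s≤s ≤-refl) (≤-trans (+-mono-≤ 0<shared₁ 0<shared₃)
                                   (common-blocks≤1 once {ofType 1} {ofType 3} ofType₁+ofType₃≤1 z≢u))

  b₄≤22 : b₄ ≤ 22
  b₄≤22 = ≮⇒≥ AtLeast23K4s.absurd

-- An optimal decomposition

D₀ : List (Block 19)
D₀ = (# 5 ∷ # 7 ∷ # 11 ∷ # 18 ∷ []) ∷ (# 4 ∷ # 10 ∷ # 16 ∷ # 18 ∷ []) ∷ (# 6 ∷ # 8 ∷ # 13 ∷ # 18 ∷ [])
   ∷ (# 3 ∷ # 14 ∷ # 15 ∷ # 18 ∷ []) ∷ (# 9 ∷ # 10 ∷ # 11 ∷ # 14 ∷ []) ∷ (# 1 ∷ # 2 ∷ # 9 ∷ # 18 ∷ [])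
   ∷ (# 2 ∷ # 3 ∷ # 6 ∷ # 10 ∷ []) ∷ (# 0 ∷ # 12 ∷ # 17 ∷ # 18 ∷ []) ∷ (# 5 ∷ # 10 ∷ # 12 ∷ # 15 ∷ [])
   ∷ (# 6 ∷ # 11 ∷ # 12 ∷ # 16 ∷ []) ∷ (# 1 ∷ # 10 ∷ # 13 ∷ # 17 ∷ []) ∷ (# 0 ∷ # 7 ∷ # 8 ∷ # 10 ∷ [])
   ∷ (# 1 ∷ # 7 ∷ # 12 ∷ # 14 ∷ []) ∷ (# 3 ∷ # 8 ∷ # 9 ∷ # 12 ∷ []) ∷ (# 2 ∷ # 4 ∷ # 12 ∷ # 13 ∷ [])
   ∷ (# 0 ∷ # 11 ∷ # 13 ∷ # 15 ∷ []) ∷ (# 3 ∷ # 7 ∷ # 13 ∷ []) ∷ (# 5 ∷ # 9 ∷ # 13 ∷ [])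
   ∷ (# 13 ∷ # 14 ∷ # 16 ∷ []) ∷ (# 1 ∷ # 3 ∷ # 4 ∷ # 11 ∷ []) ∷ (# 2 ∷ # 8 ∷ # 11 ∷ # 17 ∷ [])
   ∷ (# 0 ∷ # 2 ∷ # 14 ∷ []) ∷ (# 2 ∷ # 5 ∷ # 16 ∷ []) ∷ (# 2 ∷ # 7 ∷ # 15 ∷ []) ∷ (# 3 ∷ # 5 ∷ # 17 ∷ [])
   ∷ (# 0 ∷ # 3 ∷ # 16 ∷ []) ∷ (# 6 ∷ # 14 ∷ # 17 ∷ []) ∷ (# 1 ∷ # 8 ∷ # 15 ∷ # 16 ∷ [])
   ∷ (# 7 ∷ # 9 ∷ # 16 ∷ # 17 ∷ []) ∷ (# 4 ∷ # 15 ∷ # 17 ∷ []) ∷ (# 6 ∷ # 9 ∷ # 15 ∷ [])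
   ∷ (# 4 ∷ # 6 ∷ # 7 ∷ []) ∷ (# 0 ∷ # 4 ∷ # 9 ∷ []) ∷ (# 0 ∷ # 1 ∷ # 5 ∷ # 6 ∷ [])
   ∷ (# 4 ∷ # 5 ∷ # 8 ∷ # 14 ∷ []) ∷ []

isK3orK4? : ∀ {n} (B : Block n) → Dec (IsK3orK4 B)
isK3orK4? B = UniqueDec.unique? _≟ᶠ_ B ×-dec ((length B ≟ 3) ⊎-dec (length B ≟ 4))

D₀-decomposition : IsK34Decomposition 19 D₀
D₀-decomposition =
  from-yes (All.all? isK3orK4? D₀) ,
  from-yes (all? λ u → all? λ v → ¬? (u ≟ᶠ v) →-dec (edgeMultiplicity D₀ u v ≟ 1))

theorem6 : DK34≡ 19 35
    × (∀ (D : List (Block 19)) → IsK34Decomposition 19 D → length D ≡ 35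
         → (numK3 D ≡ 13 × numK4 D ≡ 22))
theorem6 = ((D₀ , D₀-decomposition , refl) , at-least-35) , thirteen-and-twenty-two
  where
    at-least-35 : ∀ D → IsK34Decomposition 19 D → 35 ≤ length D
    at-least-35 D decomposition =
      subst (35 ≤_) (sym length≡b₃+b₄) (a+2b≡57⇒35≤a+b b₃+2b₄≡57 b₄≤22)
      where open OnNineteenVertices D decomposition

    thirteen-and-twenty-two : ∀ D → IsK34Decomposition 19 D → length D ≡ 35 → numK3 D ≡ 13 × numK4 D ≡ 22
    thirteen-and-twenty-two D decomposition length≡35 =
      let (b₃≡13 , b₄≡22) = a+2b≡57⇒a+b≡35⇒ b₃+2b₄≡57 (trans (sym length≡b₃+b₄) length≡35)
      in trans numK3≡b₃ b₃≡13 , trans numK4≡b₄ b₄≡22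
      where open OnNineteenVertices D decomposition
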